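{- Let $G=K_{3,7}$, let $L$ be a $3$-assignment for $G$, and let $r$ be a request of $L$ whose domain $D$ satisfies $|D|=1$. Then $(G,L,r)$ is $1$-satisfiable.
   Context: A list assignment $L$ assigns to each vertex $v$ a set $L(v)$ of colors; it is a $k$-assignment if $|L(v)|=k$ for all $v$. A proper $L$-coloring is a function $f$ on $V(G)$ with $f(v)\in L(v)$ and $f(u)\neq f(v)$ for adjacent $u,v$. A request of $L$ is a function $r$ with non-empty domain $D\subseteq V(G)$ with $r(v)\in L(v)$ for $v\in D$. $(G,L,r)$ is $1$-satisfiable if there is a proper $L$-coloring $f$ of $G$ with $f(v)=r(v)$ for all $v\in D$. -}

module Defs where

open import Data.Nat using (ℕ)
open import Data.Fin using (Fin)
open import Data.Sum using (_⊎_; inj₁; inj₂)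
open import Data.Product using (_×_; Σ)
open import Data.Empty using (⊥)
open import Data.Unit using (⊤)
open import Data.Bool using (Bool; true; T)
open import Data.List using (List; length)
open import Data.List.Membership.Propositional using (_∈_)
open import Data.List.Relation.Unary.Unique.Propositional using (Unique)
open import Relation.Binary.PropositionalEquality using (_≡_)
open import Relation.Nullary using (¬_)

record Graph : Set₁ where
  field
    V   : Set
    Adj : V → V → Set
open Graph public

KAdj : (m n : ℕ) → Fin m ⊎ Fin n → Fin m ⊎ Fin n → Set
KAdj m n (inj₁ _) (inj₁ _) = ⊥
KAdj m n (inj₁ _) (inj₂ _) = ⊤
KAdj m n (inj₂ _) (inj₁ _) = ⊤
KAdj m n (inj₂ _) (inj₂ _) = ⊥

K : ℕ → ℕ → Graph
K m n = record { V = Fin m ⊎ Fin n ; Adj = KAdj m n }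

-- Colors are natural numbers; a list assignment gives each vertex a
-- finite set of colors, represented as a duplicate-free list.
ListAssignment : Graph → Set
ListAssignment G = V G → List ℕ

IsKAssignment : (G : Graph) → ℕ → ListAssignment G → Set
IsKAssignment G k L = ∀ v → Unique (L v) × length (L v) ≡ k

IsProperLColoring : (G : Graph) → ListAssignment G → (V G → ℕ) → Set
IsProperLColoring G L f =
  (∀ v → f v ∈ L v) × (∀ u v → Adj G u v → ¬ (f u ≡ f v))

-- A request of L: partial function with domain D (a decidable subset of V,
-- given by its characteristic function) and r(v) ∈ L(v) for v ∈ D.
record Request (G : Graph) (L : ListAssignment G) : Set where
  field
    D   : V G → Bool
    r   : (v : V G) → T (D v) → ℕ
    r∈L : (v : V G) (d : T (D v)) → r v d ∈ L v
open Request public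

DomainSize1 : {G : Graph} {L : ListAssignment G} → Request G L → Set
DomainSize1 {G} q = Σ (V G) λ v₀ → T (D q v₀) × (∀ v → T (D q v) → v ≡ v₀)

OneSatisfiable : (G : Graph) (L : ListAssignment G) → Request G L → Set
OneSatisfiable G L q =
  Σ (V G → ℕ) λ f → IsProperLColoring G L f × (∀ v (d : T (D q v)) → f v ≡ r q v d)

-- Colour the three vertices of the small side first, from "palettes" (sub-lists of their
-- lists), then give each vertex of the large side a colour of its list not used on the
-- small side. The latter fails only if some list of the large side equals the set of the
-- three colours chosen. Under the assumption that every choice fails, the colours of
-- different palettes never collide, so a failing choice is determined by the list that
-- blocks it: there are then at most 7 choices. The request at a small-side vertex pins
-- its palette to one colour (1·3·3 = 9 > 7 choices); a request c at a large-side vertex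
-- removes c from the small-side palettes (2·2·2 = 8 > 7 choices) and c is free for it.
module Submission where

open import Defs
open import Data.Bool using (T)
open import Data.Bool.Properties using (T-irrelevant)
open import Data.Empty using (⊥-elim)
open import Data.Fin using (Fin; zero; suc)
open import Data.Fin.Properties using (_≟_; any?; all?; ¬∀⟶∃¬; <⇒notInjective; *↔×)
open import Data.List using (List; []; _∷_; length)
open import Data.List.Membership.Propositional using (_∈_)
open import Data.List.Relation.Unary.AllPairs using ([]; _∷_)
open import Data.List.Relation.Unary.All using ([]; _∷_)
open import Data.List.Relation.Unary.Any using (here; there)
open import Data.List.Relation.Unary.Unique.Propositional using (Unique)
open import Data.Nat using (ℕ; _*_; _<_; _≤_; s≤s) renaming (_≟_ to _≟ℕ_)
open import Data.Nat.Properties using (≤-refl; m≤n⇒m≤1+n)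
open import Data.Product using (Σ; Σ-syntax; ∃; _×_; _,_; proj₁; proj₂)
open import Data.Product.Function.NonDependent.Propositional using (_×-↔_)
open import Data.Sum using (_⊎_; inj₁; inj₂; [_,_])
open import Data.Unit using (tt)
open import Data.Vec.Functional using (updateAt)
open import Data.Vec.Functional.Properties using (updateAt-updates; updateAt-minimal)
open import Function using (_∘_; const)
open import Function.Bundles using (Injection; Inverse; _↔_)
open import Function.Definitions using (Injective)
open import Function.Properties.Inverse using (↔-refl; ↔-trans; ↔⇒↣)
open import Relation.Binary.PropositionalEquality using (_≡_; _≢_; refl; sym; trans; cong; cong₂; subst)
open import Relation.Nullary using (¬_; Dec; yes; no; contradiction)
open import Relation.Nullary.Decidable using (_⊎-dec_)

OneOf : ℕ → ℕ → ℕ → ℕ → Set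
OneOf s u w y = y ≡ s ⊎ y ≡ u ⊎ y ≡ w

oneOf? : ∀ s u w y → Dec (OneOf s u w y)
oneOf? s u w y = (y ≟ℕ s) ⊎-dec (y ≟ℕ u) ⊎-dec (y ≟ℕ w)

module _ {s u w y : ℕ} where

  swap₁₂ : OneOf s u w y → OneOf u s w y
  swap₁₂ (inj₁ y≡s)        = inj₂ (inj₁ y≡s)
  swap₁₂ (inj₂ (inj₁ y≡u)) = inj₁ y≡u
  swap₁₂ (inj₂ (inj₂ y≡w)) = inj₂ (inj₂ y≡w)

  swap₂₃ : OneOf s u w y → OneOf s w u y
  swap₂₃ (inj₁ y≡s)        = inj₁ y≡s
  swap₂₃ (inj₂ (inj₁ y≡u)) = inj₂ (inj₂ y≡u)
  swap₂₃ (inj₂ (inj₂ y≡w)) = inj₂ (inj₁ y≡w)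

  oneOf-first : OneOf s u w y → y ≢ u → y ≢ w → y ≡ s
  oneOf-first (inj₁ y≡s)        _   _   = y≡s
  oneOf-first (inj₂ (inj₁ y≡u)) y≢u _   = contradiction y≡u y≢u
  oneOf-first (inj₂ (inj₂ y≡w)) _   y≢w = contradiction y≡w y≢w

colours₂ : ℕ → ℕ → Fin 2 → ℕ
colours₂ x y zero       = x
colours₂ x y (suc zero) = y

colours₃ : ℕ → ℕ → ℕ → Fin 3 → ℕ
colours₃ x y z zero             = x
colours₃ x y z (suc zero)       = y
colours₃ x y z (suc (suc zero)) = z

lookup-oneOf : (g : Fin 3 → ℕ) (i : Fin 3) → OneOf (g zero) (g (suc zero)) (g (suc (suc zero))) (g i)
lookup-oneOf g zero             = inj₁ refl
lookup-oneOf g (suc zero)       = inj₂ (inj₁ refl)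
lookup-oneOf g (suc (suc zero)) = inj₂ (inj₂ refl)

record Triple : Set where
  constructor triple
  field
    e₀ e₁ e₂ : ℕ
    e₀≢e₁ : e₀ ≢ e₁
    e₀≢e₂ : e₀ ≢ e₂
    e₁≢e₂ : e₁ ≢ e₂
open Triple

infix 4 _∈ₜ_
_∈ₜ_ : ℕ → Triple → Set
y ∈ₜ t = OneOf (e₀ t) (e₁ t) (e₂ t) y

listTriple : {l : List ℕ} → Unique l → length l ≡ 3 →
             Σ[ t ∈ Triple ] (∀ {y} → y ∈ₜ t → y ∈ l) × (∀ {y} → y ∈ l → y ∈ₜ t)
listTriple {a ∷ b ∷ c ∷ []} ((a≢b ∷ a≢c ∷ []) ∷ (b≢c ∷ []) ∷ [] ∷ []) refl =
  triple a b c a≢b a≢c b≢c , to , from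
  where
    to : ∀ {y} → OneOf a b c y → y ∈ a ∷ b ∷ c ∷ []
    to (inj₁ y≡a)        = here y≡a
    to (inj₂ (inj₁ y≡b)) = there (here y≡b)
    to (inj₂ (inj₂ y≡c)) = there (there (here y≡c))
    from : ∀ {y} → y ∈ a ∷ b ∷ c ∷ [] → OneOf a b c y
    from (here y≡a)                 = inj₁ y≡a
    from (there (here y≡b))         = inj₂ (inj₁ y≡b)
    from (there (there (here y≡c))) = inj₂ (inj₂ y≡c)

triple⊈pair : ∀ t {a b} → ¬ (∀ {y} → y ∈ₜ t → y ≡ a ⊎ y ≡ b)
triple⊈pair t ⊆ab with ⊆ab (inj₁ refl) | ⊆ab (inj₂ (inj₁ refl)) | ⊆ab (inj₂ (inj₂ refl))
... | inj₁ refl | inj₁ refl | _         = e₀≢e₁ t refl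
... | inj₂ refl | inj₂ refl | _         = e₀≢e₁ t refl
... | inj₁ refl | inj₂ _    | inj₁ refl = e₀≢e₂ t refl
... | inj₂ refl | inj₁ _    | inj₂ refl = e₀≢e₂ t refl
... | inj₁ _    | inj₂ refl | inj₂ refl = e₁≢e₂ t refl
... | inj₂ _    | inj₁ refl | inj₁ refl = e₁≢e₂ t refl

CoveredBy : Triple → ℕ → ℕ → ℕ → Set
CoveredBy t s u w = ∀ {y} → y ∈ₜ t → OneOf s u w y

Avoids : Triple → ℕ → ℕ → ℕ → Set
Avoids t s u w = ∃ λ y → y ∈ₜ t × ¬ OneOf s u w y

module _ (t : Triple) {s u w : ℕ} where

  avoids-or-coveredBy : Avoids t s u w ⊎ CoveredBy t s u w
  avoids-or-coveredBy
    with oneOf? s u w (e₀ t) | oneOf? s u w (e₁ t) | oneOf? s u w (e₂ t)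
  ... | no ∉    | _      | _      = inj₁ (e₀ t , inj₁ refl , ∉)
  ... | yes _  | no ∉   | _      = inj₁ (e₁ t , inj₂ (inj₁ refl) , ∉)
  ... | yes _  | yes _  | no ∉   = inj₁ (e₂ t , inj₂ (inj₂ refl) , ∉)
  ... | yes ∈₀ | yes ∈₁ | yes ∈₂ = inj₂ λ where
    (inj₁ refl)        → ∈₀
    (inj₂ (inj₁ refl)) → ∈₁
    (inj₂ (inj₂ refl)) → ∈₂

  avoids? : Dec (Avoids t s u w)
  avoids? with avoids-or-coveredBy
  ... | inj₁ avoids  = yes avoids
  ... | inj₂ covered = no λ (_ , y∈t , y∉) → y∉ (covered y∈t)

  ¬avoids⇒coveredBy : ¬ Avoids t s u w → CoveredBy t s u w
  ¬avoids⇒coveredBy ¬avoids with avoids-or-coveredBy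
  ... | inj₁ avoids  = contradiction avoids ¬avoids
  ... | inj₂ covered = covered

  coveredBy⇒∈ : CoveredBy t s u w → s ∈ₜ t
  coveredBy⇒∈ covered with oneOf? (e₀ t) (e₁ t) (e₂ t) s
  ... | yes s∈t = s∈t
  ... | no s∉t  = ⊥-elim (triple⊈pair t λ y∈t → drop-s y∈t (covered y∈t))
    where
      drop-s : ∀ {y} → y ∈ₜ t → OneOf s u w y → y ≡ u ⊎ y ≡ w
      drop-s y∈t (inj₁ refl) = contradiction y∈t s∉t
      drop-s _   (inj₂ y∈uw) = y∈uw

  coveredBy⇒≢ : CoveredBy t s u w → s ≢ u
  coveredBy⇒≢ covered refl = triple⊈pair t (merge ∘ covered)
    where
      merge : ∀ {y} → OneOf s s w y → y ≡ s ⊎ y ≡ w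
      merge (inj₁ y≡s)        = inj₁ y≡s
      merge (inj₂ (inj₁ y≡s)) = inj₁ y≡s
      merge (inj₂ (inj₂ y≡w)) = inj₂ y≡w

coveredBy⇒distinct : ∀ t {s u w} → CoveredBy t s u w → s ≢ u × s ≢ w × u ≢ w
coveredBy⇒distinct t covered =
  coveredBy⇒≢ t covered , coveredBy⇒≢ t (swap₂₃ ∘ covered) ,
  coveredBy⇒≢ t (swap₂₃ ∘ swap₁₂ ∘ covered)

coveredBy⇒⊇ : ∀ t {s u w} → CoveredBy t s u w → s ∈ₜ t × u ∈ₜ t × w ∈ₜ t
coveredBy⇒⊇ t covered =
  coveredBy⇒∈ t covered , coveredBy⇒∈ t (swap₁₂ ∘ covered) ,
  coveredBy⇒∈ t (swap₁₂ ∘ swap₂₃ ∘ covered)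

record Palette (t : Triple) (n : ℕ) : Set where
  field
    colour           : Fin n → ℕ
    colour-injective : Injective _≡_ _≡_ colour
    colour-∈         : ∀ k → colour k ∈ₜ t
open Palette

full : ∀ t → Palette t 3
full t = record
  { colour           = (colours₃ (e₀ t) (e₁ t) (e₂ t))
  ; colour-injective = injective
  ; colour-∈         = lookup-oneOf ((colours₃ (e₀ t) (e₁ t) (e₂ t)))
  }
  where
    injective : Injective _≡_ _≡_ ((colours₃ (e₀ t) (e₁ t) (e₂ t)))
    injective {zero}          {zero}          _ = refl
    injective {zero}          {suc zero}      e = contradiction e (e₀≢e₁ t)
    injective {zero}          {suc (suc zero)} e = contradiction e (e₀≢e₂ t)
    injective {suc zero}      {zero}          e = contradiction (sym e) (e₀≢e₁ t)
    injective {suc zero}      {suc zero}      _ = refl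
    injective {suc zero}      {suc (suc zero)} e = contradiction e (e₁≢e₂ t)
    injective {suc (suc zero)} {zero}          e = contradiction (sym e) (e₀≢e₂ t)
    injective {suc (suc zero)} {suc zero}      e = contradiction (sym e) (e₁≢e₂ t)
    injective {suc (suc zero)} {suc (suc zero)} _ = refl

singleton : ∀ {t c} → c ∈ₜ t → Palette t 1
singleton {c = c} c∈t = record
  { colour           = const c
  ; colour-injective = λ { {zero} {zero} _ → refl }
  ; colour-∈         = const c∈t
  }

pair : ∀ {t x y} → x ≢ y → x ∈ₜ t → y ∈ₜ t → Palette t 2
pair {x = x} {y} x≢y x∈t y∈t = record
  { colour           = (colours₂ x y)
  ; colour-injective = injective
  ; colour-∈         = λ { zero → x∈t ; (suc zero) → y∈t }
  }
  where
    injective : Injective _≡_ _≡_ ((colours₂ x y))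
    injective {zero}     {zero}     _ = refl
    injective {zero}     {suc zero} e = contradiction e x≢y
    injective {suc zero} {zero}     e = contradiction (sym e) x≢y
    injective {suc zero} {suc zero} _ = refl

PaletteAvoiding : Triple → ℕ → Set
PaletteAvoiding t c = Σ[ P ∈ Palette t 2 ] ∀ k → colour P k ≢ c

without : ∀ t c → PaletteAvoiding t c
without t c with c ≟ℕ e₀ t | c ≟ℕ e₁ t
... | yes refl | _ = pair (e₁≢e₂ t) (inj₂ (inj₁ refl)) (inj₂ (inj₂ refl)) , λ where
  zero       → e₀≢e₁ t ∘ sym
  (suc zero) → e₀≢e₂ t ∘ sym
... | no c≢e₀ | yes refl = pair (e₀≢e₂ t) (inj₁ refl) (inj₂ (inj₂ refl)) , λ where
  zero       → e₀≢e₁ t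
  (suc zero) → e₁≢e₂ t ∘ sym
... | no c≢e₀ | no c≢e₁ = pair (e₀≢e₁ t) (inj₁ refl) (inj₂ (inj₁ refl)) , λ where
  zero       → c≢e₀ ∘ sym
  (suc zero) → c≢e₁ ∘ sym

module _ {m} (blockers : Fin m → Triple) {t₀ t₁ t₂ n₀ n₁ n₂}
         (P₀ : Palette t₀ n₀) (P₁ : Palette t₁ n₁) (P₂ : Palette t₂ n₂) where

  Unblocked : Fin m → Fin n₀ → Fin n₁ → Fin n₂ → Set
  Unblocked j a b c = Avoids (blockers j) (colour P₀ a) (colour P₁ b) (colour P₂ c)

  Free : Fin n₀ → Fin n₁ → Fin n₂ → Set
  Free a b c = ∀ j → Unblocked j a b c

  BlockedBy : Fin m → Fin n₀ → Fin n₁ → Fin n₂ → Set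
  BlockedBy j a b c = CoveredBy (blockers j) (colour P₀ a) (colour P₁ b) (colour P₂ c)

  free-choice : m < n₀ * (n₁ * n₂) → Σ[ a ∈ Fin n₀ ] Σ[ b ∈ Fin n₁ ] Σ[ c ∈ Fin n₂ ] Free a b c
  free-choice m<N with any? (λ a → any? (λ b → any? (λ c → all? (λ j → avoids? (blockers j)))))
  ... | yes free = free
  ... | no none  = ⊥-elim (<⇒notInjective m<N encoded-blocker-injective)
    where
      blocked : ∀ a b c → ∃ λ j → BlockedBy j a b c
      blocked a b c with ¬∀⟶∃¬ m (λ j → Unblocked j a b c) (λ j → avoids? (blockers j)) (λ free → none (a , b , c , free))
      ... | j , ¬avoids = j , ¬avoids⇒coveredBy (blockers j) ¬avoids

      distinct : ∀ a b c → colour P₀ a ≢ colour P₁ b × colour P₀ a ≢ colour P₂ c × colour P₁ b ≢ colour P₂ c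
      distinct a b c = coveredBy⇒distinct (blockers (proj₁ (blocked a b c))) (proj₂ (blocked a b c))

      blocker : Fin n₀ × Fin n₁ × Fin n₂ → Fin m
      blocker (a , b , c) = proj₁ (blocked a b c)

      -- Comparing with the mixed choices (a , b' , c'), (a' , b , c') and (a' , b' , c),
      -- which are blocked too, shows that the colours of different palettes never meet.
      blocker-injective : Injective _≡_ _≡_ blocker
      blocker-injective {a , b , c} {a' , b' , c'} same-blocker =
        cong₂ _,_ (colour-injective P₀ a≡a') (cong₂ _,_ (colour-injective P₁ b≡b') (colour-injective P₂ c≡c'))
        where
          j = blocker (a , b , c)
          covered' : BlockedBy j a' b' c'
          covered' = subst (λ j → BlockedBy j a' b' c') (sym same-blocker) (proj₂ (blocked a' b' c'))
          abc⊆ = coveredBy⇒⊇ (blockers j) (proj₂ (blocked a b c))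
          a∈ = proj₁ abc⊆
          b∈ = proj₁ (proj₂ abc⊆)
          c∈ = proj₂ (proj₂ abc⊆)
          a≡a' = oneOf-first (covered' a∈) (proj₁ (distinct a b' c')) (proj₁ (proj₂ (distinct a b' c')))
          b≡b' = oneOf-first (swap₁₂ (covered' b∈)) (proj₁ (distinct a' b c') ∘ sym) (proj₂ (proj₂ (distinct a' b c')))
          c≡c' = oneOf-first (swap₁₂ (swap₂₃ (covered' c∈)))
                   (proj₁ (proj₂ (distinct a' b' c)) ∘ sym) (proj₂ (proj₂ (distinct a' b' c)) ∘ sym)

      choices : Fin (n₀ * (n₁ * n₂)) ↔ (Fin n₀ × Fin n₁ × Fin n₂)
      choices = ↔-trans (*↔× {n₀}) (↔-refl ×-↔ *↔× {n₁})

      encoded-blocker-injective : Injective _≡_ _≡_ (blocker ∘ Inverse.to choices)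
      encoded-blocker-injective {x} {y} = Injection.injective (↔⇒↣ choices) {x} {y} ∘ blocker-injective

join-proper : ∀ {m n} (L : ListAssignment (K m n)) {g : Fin m → ℕ} {h : Fin n → ℕ} →
              (∀ i → g i ∈ L (inj₁ i)) → (∀ j → h j ∈ L (inj₂ j)) → (∀ i j → g i ≢ h j) →
              IsProperLColoring (K m n) L [ g , h ]
join-proper L g∈ h∈ g≢h = membership , separation
  where
    membership : ∀ v → [ _ , _ ] v ∈ L v
    membership (inj₁ i) = g∈ i
    membership (inj₂ j) = h∈ j
    separation : ∀ u v → KAdj _ _ u v → [ _ , _ ] u ≢ [ _ , _ ] v
    separation (inj₁ i) (inj₂ j) _ = g≢h i j
    separation (inj₂ j) (inj₁ i) _ = g≢h i j ∘ sym

recolour-right : ∀ {m n} {L : ListAssignment (K m n)} {g : Fin m → ℕ} {h : Fin n → ℕ} {j y} →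
                 IsProperLColoring (K m n) L [ g , h ] → y ∈ L (inj₂ j) → (∀ i → g i ≢ y) →
                 IsProperLColoring (K m n) L [ g , updateAt h j (const y) ]
recolour-right {L = L} {g} {h} {j} {y} (∈L , proper) y∈L g≢y =
  join-proper L (∈L ∘ inj₁) h'∈L g≢h'
  where
    h'∈L : ∀ j' → updateAt h j (const y) j' ∈ L (inj₂ j')
    h'∈L j' with j' ≟ j
    ... | yes refl rewrite updateAt-updates j {const y} h = y∈L
    ... | no j'≢j  rewrite updateAt-minimal j' j {const y} h j'≢j = ∈L (inj₂ j')
    g≢h' : ∀ i j' → g i ≢ updateAt h j (const y) j'
    g≢h' i j' with j' ≟ j
    ... | yes refl rewrite updateAt-updates j {const y} h = g≢y i
    ... | no j'≢j  rewrite updateAt-minimal j' j {const y} h j'≢j = proper (inj₁ i) (inj₂ j') tt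

honours-singleton-request : ∀ {G L} (q : Request G L) {v₀} (d₀ : T (D q v₀)) →
                            (∀ v → T (D q v) → v ≡ v₀) → {f : V G → ℕ} →
                            f v₀ ≡ r q v₀ d₀ → ∀ v d → f v ≡ r q v d
honours-singleton-request q d₀ only-v₀ f-v₀ v d with only-v₀ v d
... | refl = trans f-v₀ (cong (r q v) (T-irrelevant d₀ d))

module K3 {n} (n≤7 : n ≤ 7) (L : ListAssignment (K 3 n)) (isK : IsKAssignment (K 3 n) 3 L) where

  list : V (K 3 n) → Triple
  list v = proj₁ (listTriple (proj₁ (isK v)) (proj₂ (isK v)))

  ∈ₜ⇒∈ : ∀ {v y} → y ∈ₜ list v → y ∈ L v
  ∈ₜ⇒∈ {v} = proj₁ (proj₂ (listTriple (proj₁ (isK v)) (proj₂ (isK v))))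

  ∈⇒∈ₜ : ∀ {v y} → y ∈ L v → y ∈ₜ list v
  ∈⇒∈ₜ {v} = proj₂ (proj₂ (listTriple (proj₁ (isK v)) (proj₂ (isK v))))

  palette-colouring : ∀ {n₀ n₁ n₂} (P₀ : Palette (list (inj₁ zero)) n₀)
                      (P₁ : Palette (list (inj₁ (suc zero))) n₁) (P₂ : Palette (list (inj₁ (suc (suc zero)))) n₂) →
                      n < n₀ * (n₁ * n₂) →
                      Σ[ a ∈ Fin n₀ ] Σ[ b ∈ Fin n₁ ] Σ[ c ∈ Fin n₂ ] Σ[ h ∈ (Fin n → ℕ) ]
                        IsProperLColoring (K 3 n) L [ colours₃ (colour P₀ a) (colour P₁ b) (colour P₂ c) , h ]
  palette-colouring P₀ P₁ P₂ n<N with free-choice (list ∘ inj₂) P₀ P₁ P₂ n<N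
  ... | a , b , c , free = a , b , c , proj₁ ∘ free , join-proper L g∈L h∈L g≢h
    where
      g : Fin 3 → ℕ
      g = colours₃ (colour P₀ a) (colour P₁ b) (colour P₂ c)
      g∈L : ∀ i → g i ∈ L (inj₁ i)
      g∈L zero             = ∈ₜ⇒∈ (colour-∈ P₀ a)
      g∈L (suc zero)       = ∈ₜ⇒∈ (colour-∈ P₁ b)
      g∈L (suc (suc zero)) = ∈ₜ⇒∈ (colour-∈ P₂ c)
      h∈L : ∀ j → proj₁ (free j) ∈ L (inj₂ j)
      h∈L j = ∈ₜ⇒∈ (proj₁ (proj₂ (free j)))
      g≢h : ∀ i j → g i ≢ proj₁ (free j)
      g≢h i j g≡h = proj₂ (proj₂ (free j)) (subst (OneOf _ _ _) g≡h (lookup-oneOf g i))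

  ColouringWith : V (K 3 n) → ℕ → Set
  ColouringWith v c = Σ[ f ∈ (V (K 3 n) → ℕ) ] IsProperLColoring (K 3 n) L f × f v ≡ c

  n<9 : n < 9
  n<9 = s≤s (m≤n⇒m≤1+n n≤7)

  colouring-with-left : ∀ i {c} → c ∈ₜ list (inj₁ i) → ColouringWith (inj₁ i) c
  colouring-with-left zero c∈ =
    let _ , _ , _ , _ , proper = palette-colouring (singleton c∈) (full _) (full _) n<9 in _ , proper , refl
  colouring-with-left (suc zero) c∈ =
    let _ , _ , _ , _ , proper = palette-colouring (full _) (singleton c∈) (full _) n<9 in _ , proper , refl
  colouring-with-left (suc (suc zero)) c∈ =
    let _ , _ , _ , _ , proper = palette-colouring (full _) (full _) (singleton c∈) n<9 in _ , proper , refl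

  colouring-with-right : ∀ j {c} → c ∈ₜ list (inj₂ j) → ColouringWith (inj₂ j) c
  colouring-with-right j {c} c∈ = recolour (without _ c) (without _ c) (without _ c)
    where
      recolour : PaletteAvoiding (list (inj₁ zero)) c → PaletteAvoiding (list (inj₁ (suc zero))) c →
                 PaletteAvoiding (list (inj₁ (suc (suc zero)))) c → ColouringWith (inj₂ j) c
      recolour (P₀ , P₀≢c) (P₁ , P₁≢c) (P₂ , P₂≢c) =
        let a , b , d , h , proper = palette-colouring P₀ P₁ P₂ (s≤s n≤7)
            g≢c : ∀ i → colours₃ (colour P₀ a) (colour P₁ b) (colour P₂ d) i ≢ c
            g≢c = λ where
              zero             → P₀≢c a
              (suc zero)       → P₁≢c b
              (suc (suc zero)) → P₂≢c d
        in _ , recolour-right proper (∈ₜ⇒∈ c∈) g≢c , updateAt-updates j {const c} h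

  colouring-with : ∀ v {c} → c ∈ L v → ColouringWith v c
  colouring-with (inj₁ i) = colouring-with-left i ∘ ∈⇒∈ₜ
  colouring-with (inj₂ j) = colouring-with-right j ∘ ∈⇒∈ₜ

lemma1 : (L : ListAssignment (K 3 7)) → IsKAssignment (K 3 7) 3 L →
    (q : Request (K 3 7) L) → DomainSize1 q → OneSatisfiable (K 3 7) L q
lemma1 L isK q (v₀ , d₀ , only-v₀) with K3.colouring-with ≤-refl L isK v₀ (r∈L q v₀ d₀)
... | f , proper , f-v₀ = f , proper , honours-singleton-request q d₀ only-v₀ f-v₀
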